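{- wBIL is not finitely equivalential: there is no finite set $\Delta(x,y)$ of formulas in the two variables $x,y$ satisfying (R) $\vdash_w\Delta(x,x)$; (MP') $x,\Delta(x,y)\vdash_w y$; and (Re) for every connective $\lambda\in\{\top,\bot,\wedge,\vee,\to,\prec\}$ of arity $n$, $\Delta(x_1,y_1),\dots,\Delta(x_n,y_n)\vdash_w\Delta(\lambda x_1\dots x_n,\lambda y_1\dots y_n)$.
   Context: Fix a countably infinite set $\mathrm{Prop}$ of propositional variables. Bi-intuitionistic formulas are generated by $\phi ::= p \mid \bot \mid \top \mid \phi\wedge\phi \mid \phi\vee\phi \mid \phi\to\phi \mid \phi\prec\phi$ with $p\in\mathrm{Prop}$ ($\prec$ is exclusion). Abbreviations: $\neg\phi := \phi\to\bot$, ${\sim}\phi := \top\prec\phi$. An axiom is any instance of: (A1) $\phi\to(\psi\to\phi)$; (A2) $(\phi\to(\psi\to\chi))\to((\phi\to\psi)\to(\phi\to\chi))$; (A3) $\phi\to(\phi\vee\psi)$; (A4) $\psi\to(\phi\vee\psi)$; (A5) $(\phi\to\chi)\to((\psi\to\chi)\to((\phi\vee\psi)\to\chi))$; (A6) $(\phi\wedge\psi)\to\phi$; (A7) $(\phi\wedge\psi)\to\psi$; (A8) $(\chi\to\phi)\to((\chi\to\psi)\to(\chi\to(\phi\wedge\psi)))$; (A9) $\bot\to\phi$; (A10) $\phi\to\top$; (A11) $\phi\to(\psi\vee(\phi\prec\psi))$; (A12) $(\phi\prec\psi)\to{\sim}(\phi\to\psi)$; (A13) $((\phi\prec\psi)\prec\chi)\to(\phi\prec(\psi\vee\chi))$;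 (A14) $\neg(\phi\prec\psi)\to(\phi\to\psi)$. wBIL is the relation $\Gamma\vdash_w\phi$ holding iff $\Gamma\vdash\phi$ is derivable with: (Ax) $\Gamma\vdash\phi$ for any axiom $\phi$; (El) $\Gamma\vdash\phi$ if $\phi\in\Gamma$; (MP) from $\Gamma\vdash\phi$ and $\Gamma\vdash\phi\to\psi$ infer $\Gamma\vdash\psi$; (wDN) from $\emptyset\vdash\phi$ infer $\Gamma\vdash\neg{\sim}\phi$. $\Delta(\phi,\psi)$ denotes substitution of $\phi,\psi$ for $x,y$; a set on the right of $\vdash_w$ means each member is derivable. -}

module Defs where

open import Data.Nat using (ℕ; zero; suc; _+_; _*_)
open import Data.Fin using (Fin; zero; suc; toℕ)
open import Data.List using (List; map)
open import Data.List.Membership.Propositional using (_∈_)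
open import Data.Product using (Σ; ∃; _×_; _,_)
open import Data.Sum using (_⊎_)
open import Data.Empty using (⊥)
open import Relation.Binary.PropositionalEquality using (_≡_)
open import Relation.Nullary using (¬_)

data Fm (V : Set) : Set where
  var  : V → Fm V
  ⊥ᶠ   : Fm V
  ⊤ᶠ   : Fm V
  _∧ᶠ_ : Fm V → Fm V → Fm V
  _∨ᶠ_ : Fm V → Fm V → Fm V
  _⇒_  : Fm V → Fm V → Fm V
  _≺_  : Fm V → Fm V → Fm V

infixr 5 _⇒_
infixl 6 _∨ᶠ_
infixl 7 _∧ᶠ_
infixl 8 _≺_

Formula : Set
Formula = Fm ℕ

sub : {V W : Set} → (V → Fm W) → Fm V → Fm W
sub σ (var v)  = σ v
sub σ ⊥ᶠ       = ⊥ᶠ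
sub σ ⊤ᶠ       = ⊤ᶠ
sub σ (a ∧ᶠ b) = sub σ a ∧ᶠ sub σ b
sub σ (a ∨ᶠ b) = sub σ a ∨ᶠ sub σ b
sub σ (a ⇒ b)  = sub σ a ⇒ sub σ b
sub σ (a ≺ b)  = sub σ a ≺ sub σ b

¬ᶠ_ : Formula → Formula
¬ᶠ φ = φ ⇒ ⊥ᶠ

∼_ : Formula → Formula
∼ φ = ⊤ᶠ ≺ φ

data Axiom : Formula → Set where
  A1  : ∀ φ ψ → Axiom (φ ⇒ (ψ ⇒ φ))
  A2  : ∀ φ ψ χ → Axiom ((φ ⇒ (ψ ⇒ χ)) ⇒ ((φ ⇒ ψ) ⇒ (φ ⇒ χ)))
  A3  : ∀ φ ψ → Axiom (φ ⇒ (φ ∨ᶠ ψ))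
  A4  : ∀ φ ψ → Axiom (ψ ⇒ (φ ∨ᶠ ψ))
  A5  : ∀ φ ψ χ → Axiom ((φ ⇒ χ) ⇒ ((ψ ⇒ χ) ⇒ ((φ ∨ᶠ ψ) ⇒ χ)))
  A6  : ∀ φ ψ → Axiom ((φ ∧ᶠ ψ) ⇒ φ)
  A7  : ∀ φ ψ → Axiom ((φ ∧ᶠ ψ) ⇒ ψ)
  A8  : ∀ φ ψ χ → Axiom ((χ ⇒ φ) ⇒ ((χ ⇒ ψ) ⇒ (χ ⇒ (φ ∧ᶠ ψ))))
  A9  : ∀ φ → Axiom (⊥ᶠ ⇒ φ)
  A10 : ∀ φ → Axiom (φ ⇒ ⊤ᶠ)
  A11 : ∀ φ ψ → Axiom (φ ⇒ (ψ ∨ᶠ (φ ≺ ψ)))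
  A12 : ∀ φ ψ → Axiom ((φ ≺ ψ) ⇒ ∼ (φ ⇒ ψ))
  A13 : ∀ φ ψ χ → Axiom (((φ ≺ ψ) ≺ χ) ⇒ (φ ≺ (ψ ∨ᶠ χ)))
  A14 : ∀ φ ψ → Axiom ((¬ᶠ (φ ≺ ψ)) ⇒ (φ ⇒ ψ))

FSet : Set₁
FSet = Formula → Set

∅ : FSet
∅ _ = ⊥

data _⊢w_ (Γ : FSet) : Formula → Set where
  ax  : ∀ {φ} → Axiom φ → Γ ⊢w φ
  el  : ∀ {φ} → Γ φ → Γ ⊢w φ
  mp  : ∀ {φ ψ} → Γ ⊢w φ → Γ ⊢w (φ ⇒ ψ) → Γ ⊢w ψ
  wdn : ∀ {φ} → ∅ ⊢w φ → Γ ⊢w (¬ᶠ (∼ φ))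

infix 3 _⊢w_

-- Δ(φ, ψ): substitute φ, ψ for the two variables x (= zero), y (= suc zero).
Two : Set
Two = Fin 2

⟨_,_⟩ : Formula → Formula → Two → Formula
⟨ φ , ψ ⟩ zero       = φ
⟨ φ , ψ ⟩ (suc zero) = ψ

Δ[_,_]_ : Formula → Formula → List (Fm Two) → List Formula
Δ[ φ , ψ ] Δ = map (sub ⟨ φ , ψ ⟩) Δ

_⊢w*_ : FSet → List Formula → Set
Γ ⊢w* L = ∀ δ → δ ∈ L → Γ ⊢w δ

⟪_⟫ : List Formula → FSet
⟪ L ⟫ φ = φ ∈ L

data Conn : Set where
  c⊤ c⊥ c∧ c∨ c⇒ c≺ : Conn

arity : Conn → ℕ
arity c⊤ = 0
arity c⊥ = 0
arity c∧ = 2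
arity c∨ = 2
arity c⇒ = 2
arity c≺ = 2

applyC : (c : Conn) → (Fin (arity c) → Formula) → Formula
applyC c⊤ a = ⊤ᶠ
applyC c⊥ a = ⊥ᶠ
applyC c∧ a = a zero ∧ᶠ a (suc zero)
applyC c∨ a = a zero ∨ᶠ a (suc zero)
applyC c⇒ a = a zero ⇒ a (suc zero)
applyC c≺ a = a zero ≺ a (suc zero)

x y : Formula
x = var 0
y = var 1

xs ys : (n : ℕ) → Fin n → Formula
xs n i = var (2 * toℕ i)
ys n i = var (suc (2 * toℕ i))

CondR : List (Fm Two) → Set
CondR Δ = ∅ ⊢w* (Δ[ x , x ] Δ)

CondMP : List (Fm Two) → Set
CondMP Δ = (λ φ → φ ≡ x ⊎ φ ∈ Δ[ x , y ] Δ) ⊢w y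

CondRe : List (Fm Two) → Set
CondRe Δ = ∀ (c : Conn) →
  (λ φ → Σ (Fin (arity c)) (λ i → φ ∈ Δ[ xs (arity c) i , ys (arity c) i ] Δ))
    ⊢w* (Δ[ applyC c (xs (arity c)) , applyC c (ys (arity c)) ] Δ)

FinitelyEquivalential : Set
FinitelyEquivalential = Σ (List (Fm Two)) (λ Δ → CondR Δ × CondMP Δ × CondRe Δ)

-- Truth at a world of a Kripke model is sound for wBIL (wDN only needs its premise to be
-- valid). Work in the infinite fence lo 0 ≼ hi 0 ≽ lo 1 ≼ hi 1 ≽ …, at the world lo 0. A formula
-- of ⇒/≺-depth d evaluated at lo 0 only inspects worlds of index ≤ d, so once N exceeds the
-- depth of every member of Δ, Δ(⊤, Y) holds at lo 0 for the upset Y = punctured N, which fails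
-- only at lo N. By (R) and (Re), Δ(Eⱼ ⊤, Eⱼ Y) and Δ(¬Eⱼ ⊤, ¬Eⱼ Y) then hold at lo 0 for the
-- towers Eⱼ z = (∼¬)ʲ ∼ z. But Eⱼ ⊤ fails everywhere, while each ∼¬ moves the failure of Y one
-- world down the fence, so E_N Y holds at lo 0: ¬E_N ⊤ holds at lo 0 and ¬E_N Y does not,
-- contradicting (MP').

module Submission where

open import Defs
open import Data.Bool using (Bool; true; false; T; not; _∧_; _∨_)
open import Data.Bool.ListAction using (and; or; all; any)
open import Data.Bool.Properties using (T-∧; T-∨)
open import Data.Fin using (zero; suc)
open import Data.List using (List; []; _∷_; map)
open import Data.List.Extrema.Nat using (max; xs≤max)
open import Data.List.Membership.Propositional using (_∈_; find; lose)
open import Data.List.Membership.Propositional.Properties using (∈-map⁺; ∈-map⁻)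
open import Data.List.Properties using (map-cong-local)
open import Data.List.Relation.Unary.All as All using (All; []; _∷_)
open import Data.List.Relation.Unary.All.Properties using (all⁺; all⁻)
open import Data.List.Relation.Unary.Any using (here; there)
open import Data.List.Relation.Unary.Any.Properties using (any⁺; any⁻)
open import Data.Nat using (ℕ; zero; suc; _+_; _≤_; _<_; _⊔_; _≡ᵇ_; z≤n; s≤s)
open import Data.Nat.Properties using (≤-refl; ≤-trans; m≤m+n; n≤1+n; m≤n⇒m≤1+n; +-suc; +-identityʳ; m⊔n≤o⇒m≤o; m⊔n≤o⇒n≤o)
open import Data.Product using (∃; _×_; _,_; proj₁; proj₂)
open import Data.Sum as Sum using (_⊎_; inj₁; inj₂; [_,_])
open import Function using (_∘_; const)
open import Function.Bundles using (_⇔_; mk⇔; Equivalence)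
open import Relation.Binary.PropositionalEquality using (_≡_; _≗_; refl; sym; trans; cong; cong₂; subst)
open import Relation.Nullary using (¬_)
open import Relation.Nullary.Decidable using (T?; toSum; decidable-stable)

open Equivalence using (to; from)

T-not∨ : ∀ {a b} → T (not a ∨ b) ⇔ (T a → T b)
T-not∨ {true}  = mk⇔ (λ b _ → b) (λ f → f _)
T-not∨ {false} = mk⇔ (λ _ ()) (λ _ → _)

T-∧not : ∀ {a b} → T (a ∧ not b) ⇔ (T a × ¬ T b)
T-∧not {true}  {true}  = mk⇔ (λ ()) (λ (_ , ¬b) → ¬b _)
T-∧not {true}  {false} = mk⇔ (λ _ → _ , λ ()) (λ _ → _)
T-∧not {false}         = mk⇔ (λ ()) (λ { (() , _) })

-- Frames whose worlds have finitely many, explicitly listed, successors and predecessors, so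
-- that truth at a world is a Boolean and the case splits needed for A11 and A14 are available.
record Frame : Set₁ where
  field
    World   : Set
    _≼_     : World → World → Set
    ≼-refl  : ∀ {w} → w ≼ w
    ≼-trans : ∀ {u v w} → u ≼ v → v ≼ w → u ≼ w
    up down : World → List World
    ∈-up    : ∀ {w v} → v ∈ up w ⇔ w ≼ v
    ∈-down  : ∀ {w v} → v ∈ down w ⇔ v ≼ w

module Kripke (F : Frame) where
  open Frame F

  Val : Set
  Val = World → Bool

  ⊤ᵛ ⊥ᵛ : Val
  ⊤ᵛ = const true
  ⊥ᵛ = const false

  -- Opaque so that Agda can recover f and g from (f ⇒ᵛ g) w; they are used only through the
  -- truth conditions T-∧ᵛ, …, T-≺ᵛ and the congruences below.
  opaque
    _∧ᵛ_ _∨ᵛ_ _⇒ᵛ_ _≺ᵛ_ : Val → Val → Val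
    (f ∧ᵛ g) w = f w ∧ g w
    (f ∨ᵛ g) w = f w ∨ g w
    (f ⇒ᵛ g) w = all (λ v → not (f v) ∨ g v) (up w)
    (f ≺ᵛ g) w = any (λ v → f v ∧ not (g v)) (down w)

  ¬ᵛ_ ∼ᵛ_ : Val → Val
  ¬ᵛ f = f ⇒ᵛ ⊥ᵛ
  ∼ᵛ f = ⊤ᵛ ≺ᵛ f

  Valid Refuted Upset : Val → Set
  Valid f   = ∀ w → T (f w)
  Refuted f = ∀ w → ¬ T (f w)
  Upset f   = ∀ {w v} → w ≼ v → T (f w) → T (f v)

  opaque
    unfolding _∧ᵛ_ _∨ᵛ_ _⇒ᵛ_ _≺ᵛ_

    T-∧ᵛ : ∀ {f g w} → T ((f ∧ᵛ g) w) ⇔ (T (f w) × T (g w))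
    T-∧ᵛ = T-∧

    T-∨ᵛ : ∀ {f g w} → T ((f ∨ᵛ g) w) ⇔ (T (f w) ⊎ T (g w))
    T-∨ᵛ = T-∨

    T-⇒ᵛ : ∀ {f g w} → T ((f ⇒ᵛ g) w) ⇔ (∀ {v} → w ≼ v → T (f v) → T (g v))
    T-⇒ᵛ {w = w} = mk⇔
      (λ h {v} w≼v → to T-not∨ (All.lookup (all⁺ _ (up w) h) (from ∈-up w≼v)))
      (λ h → all⁻ _ (All.tabulate λ v∈ → from T-not∨ (h (to ∈-up v∈))))

    T-≺ᵛ : ∀ {f g w} → T ((f ≺ᵛ g) w) ⇔ (∃ λ v → v ≼ w × T (f v) × ¬ T (g v))
    T-≺ᵛ {w = w} = mk⇔
      (λ h → let v , v∈ , d = find (any⁻ _ (down w) h) in v , to ∈-down v∈ , to T-∧not d)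
      (λ (v , v≼w , fv , ¬gv) → any⁺ _ (lose (from ∈-down v≼w) (from T-∧not (fv , ¬gv))))

    ∧ᵛ-cong : ∀ {f f' g g' w} → f w ≡ f' w → g w ≡ g' w → (f ∧ᵛ g) w ≡ (f' ∧ᵛ g') w
    ∧ᵛ-cong = cong₂ _∧_

    ∨ᵛ-cong : ∀ {f f' g g' w} → f w ≡ f' w → g w ≡ g' w → (f ∨ᵛ g) w ≡ (f' ∨ᵛ g') w
    ∨ᵛ-cong = cong₂ _∨_

    ⇒ᵛ-cong : ∀ {f f' g g' w} → (∀ {v} → w ≼ v → f v ≡ f' v) → (∀ {v} → w ≼ v → g v ≡ g' v) →
              (f ⇒ᵛ g) w ≡ (f' ⇒ᵛ g') w
    ⇒ᵛ-cong ef eg = cong and (map-cong-local (All.tabulate λ v∈ →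
      cong₂ (λ a b → not a ∨ b) (ef (to ∈-up v∈)) (eg (to ∈-up v∈))))

    ≺ᵛ-cong : ∀ {f f' g g' w} → (∀ {v} → v ≼ w → f v ≡ f' v) → (∀ {v} → v ≼ w → g v ≡ g' v) →
              (f ≺ᵛ g) w ≡ (f' ≺ᵛ g') w
    ≺ᵛ-cong ef eg = cong or (map-cong-local (All.tabulate λ v∈ →
      cong₂ (λ a b → a ∧ not b) (ef (to ∈-down v∈)) (eg (to ∈-down v∈))))

  ⊤ᵛ-upset : Upset ⊤ᵛ
  ⊤ᵛ-upset _ _ = _

  ⊥ᵛ-upset : Upset ⊥ᵛ
  ⊥ᵛ-upset _ ()

  ∧ᵛ-upset : ∀ {f g} → Upset f → Upset g → Upset (f ∧ᵛ g)
  ∧ᵛ-upset uf ug w≼v h = let a , b = to T-∧ᵛ h in from T-∧ᵛ (uf w≼v a , ug w≼v b)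

  ∨ᵛ-upset : ∀ {f g} → Upset f → Upset g → Upset (f ∨ᵛ g)
  ∨ᵛ-upset uf ug w≼v h = from T-∨ᵛ (Sum.map (uf w≼v) (ug w≼v) (to T-∨ᵛ h))

  ⇒ᵛ-upset : ∀ {f g} → Upset (f ⇒ᵛ g)
  ⇒ᵛ-upset w≼v h = from T-⇒ᵛ λ v≼u → to T-⇒ᵛ h (≼-trans w≼v v≼u)

  ≺ᵛ-upset : ∀ {f g} → Upset (f ≺ᵛ g)
  ≺ᵛ-upset w≼v h = let u , u≼w , fu , ¬gu = to T-≺ᵛ h in from T-≺ᵛ (u , ≼-trans u≼w w≼v , fu , ¬gu)

  ¬ᵛ-of-refuted : ∀ {f} → Refuted f → Valid (¬ᵛ f)
  ¬ᵛ-of-refuted ¬f _ = from T-⇒ᵛ λ {v} _ fv → ¬f v fv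

  ∼ᵛ-of-valid : ∀ {f} → Valid f → Refuted (∼ᵛ f)
  ∼ᵛ-of-valid f _ h = let v , _ , _ , ¬fv = to T-≺ᵛ h in ¬fv (f v)

  ⟦_⟧ : ∀ {V : Set} → Fm V → (V → Val) → Val
  ⟦ var v ⟧  ρ = ρ v
  ⟦ ⊥ᶠ ⟧     ρ = ⊥ᵛ
  ⟦ ⊤ᶠ ⟧     ρ = ⊤ᵛ
  ⟦ a ∧ᶠ b ⟧ ρ = ⟦ a ⟧ ρ ∧ᵛ ⟦ b ⟧ ρ
  ⟦ a ∨ᶠ b ⟧ ρ = ⟦ a ⟧ ρ ∨ᵛ ⟦ b ⟧ ρ
  ⟦ a ⇒ b ⟧  ρ = ⟦ a ⟧ ρ ⇒ᵛ ⟦ b ⟧ ρ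
  ⟦ a ≺ b ⟧  ρ = ⟦ a ⟧ ρ ≺ᵛ ⟦ b ⟧ ρ

  Upsets : ∀ {V : Set} → (V → Val) → Set
  Upsets ρ = ∀ v → Upset (ρ v)

  ⟦⟧-upset : ∀ {V : Set} {ρ : V → Val} → Upsets ρ → ∀ φ → Upset (⟦ φ ⟧ ρ)
  ⟦⟧-upset ups (var v)  = ups v
  ⟦⟧-upset ups ⊥ᶠ       = ⊥ᵛ-upset
  ⟦⟧-upset ups ⊤ᶠ       = ⊤ᵛ-upset
  ⟦⟧-upset ups (a ∧ᶠ b) = ∧ᵛ-upset (⟦⟧-upset ups a) (⟦⟧-upset ups b)
  ⟦⟧-upset ups (a ∨ᶠ b) = ∨ᵛ-upset (⟦⟧-upset ups a) (⟦⟧-upset ups b)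
  ⟦⟧-upset ups (a ⇒ b)  = ⇒ᵛ-upset
  ⟦⟧-upset ups (a ≺ b)  = ≺ᵛ-upset

  ⟦⟧-sub : ∀ {V U : Set} (σ : V → Fm U) {ρ : U → Val} {ρ' : V → Val} →
           (∀ v → ⟦ σ v ⟧ ρ ≗ ρ' v) → ∀ φ → ⟦ sub σ φ ⟧ ρ ≗ ⟦ φ ⟧ ρ'
  ⟦⟧-sub σ e (var v)  w = e v w
  ⟦⟧-sub σ e ⊥ᶠ       w = refl
  ⟦⟧-sub σ e ⊤ᶠ       w = refl
  ⟦⟧-sub σ e (a ∧ᶠ b) w = ∧ᵛ-cong (⟦⟧-sub σ e a w) (⟦⟧-sub σ e b w)
  ⟦⟧-sub σ e (a ∨ᶠ b) w = ∨ᵛ-cong (⟦⟧-sub σ e a w) (⟦⟧-sub σ e b w)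
  ⟦⟧-sub σ e (a ⇒ b)  w = ⇒ᵛ-cong (λ _ → ⟦⟧-sub σ e a _) (λ _ → ⟦⟧-sub σ e b _)
  ⟦⟧-sub σ e (a ≺ b)  w = ≺ᵛ-cong (λ _ → ⟦⟧-sub σ e a _) (λ _ → ⟦⟧-sub σ e b _)

  module _ {ρ : ℕ → Val} (ups : Upsets ρ) where
    private
      ↑ : ∀ φ → Upset (⟦ φ ⟧ ρ)
      ↑ = ⟦⟧-upset ups

    axiom-valid : ∀ {φ} → Axiom φ → Valid (⟦ φ ⟧ ρ)
    axiom-valid (A1 φ _) _ = from T-⇒ᵛ λ _ a → from T-⇒ᵛ λ v≼u _ → ↑ φ v≼u a
    axiom-valid (A2 _ _ _) _ =
      from T-⇒ᵛ λ _ f → from T-⇒ᵛ λ v≼u g → from T-⇒ᵛ λ u≼t a →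
        to T-⇒ᵛ (to T-⇒ᵛ f (≼-trans v≼u u≼t) a) ≼-refl (to T-⇒ᵛ g u≼t a)
    axiom-valid (A3 _ _) _ = from T-⇒ᵛ λ _ a → from T-∨ᵛ (inj₁ a)
    axiom-valid (A4 _ _) _ = from T-⇒ᵛ λ _ b → from T-∨ᵛ (inj₂ b)
    axiom-valid (A5 _ _ _) _ =
      from T-⇒ᵛ λ _ f → from T-⇒ᵛ λ v≼u g → from T-⇒ᵛ λ u≼t d →
        [ to T-⇒ᵛ f (≼-trans v≼u u≼t) , to T-⇒ᵛ g u≼t ] (to T-∨ᵛ d)
    axiom-valid (A6 _ _) _ = from T-⇒ᵛ λ _ c → proj₁ (to T-∧ᵛ c)
    axiom-valid (A7 _ _) _ = from T-⇒ᵛ λ _ c → proj₂ (to T-∧ᵛ c)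
    axiom-valid (A8 _ _ _) _ =
      from T-⇒ᵛ λ _ f → from T-⇒ᵛ λ v≼u g → from T-⇒ᵛ λ u≼t c →
        from T-∧ᵛ (to T-⇒ᵛ f (≼-trans v≼u u≼t) c , to T-⇒ᵛ g u≼t c)
    axiom-valid (A9 _) _ = from T-⇒ᵛ λ _ ()
    axiom-valid (A10 _) _ = from T-⇒ᵛ λ _ _ → _
    axiom-valid (A11 _ ψ) _ = from T-⇒ᵛ λ {v} _ a →
      from T-∨ᵛ (Sum.map₂ (λ ¬b → from T-≺ᵛ (v , ≼-refl , a , ¬b)) (toSum (T? (⟦ ψ ⟧ ρ v))))
    axiom-valid (A12 _ _) _ = from T-⇒ᵛ λ _ e →
      let u , u≼v , a , ¬b = to T-≺ᵛ e in
      from T-≺ᵛ (u , u≼v , _ , λ imp → ¬b (to T-⇒ᵛ imp ≼-refl a))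
    axiom-valid (A13 _ _ χ) _ = from T-⇒ᵛ λ _ e →
      let u , u≼v , e' , ¬c = to T-≺ᵛ e
          t , t≼u , a , ¬b = to T-≺ᵛ e'
      in from T-≺ᵛ (t , ≼-trans t≼u u≼v , a , [ ¬b , (λ c → ¬c (↑ χ t≼u c)) ] ∘ to T-∨ᵛ)
    axiom-valid (A14 _ ψ) _ = from T-⇒ᵛ λ _ n → from T-⇒ᵛ λ {u} v≼u a →
      decidable-stable (T? (⟦ ψ ⟧ ρ u)) λ ¬b → to T-⇒ᵛ n v≼u (from T-≺ᵛ (u , ≼-refl , a , ¬b))

  Sat : (ℕ → Val) → World → FSet → Set
  Sat ρ w Γ = ∀ {φ} → Γ φ → T (⟦ φ ⟧ ρ w)

  sound : ∀ {Γ φ} → Γ ⊢w φ → ∀ {ρ} → Upsets ρ → ∀ {w} → Sat ρ w Γ → T (⟦ φ ⟧ ρ w)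
  sound (ax a)   ups _   = axiom-valid ups a _
  sound (el φ∈Γ) _   sat = sat φ∈Γ
  sound (mp d e) ups sat = to T-⇒ᵛ (sound e ups sat) ≼-refl (sound d ups sat)
  sound (wdn d)  ups _   = ¬ᵛ-of-refuted (∼ᵛ-of-valid λ _ → sound d ups λ ()) _

  sound* : ∀ {Γ L} → Γ ⊢w* L → ∀ {ρ} → Upsets ρ → ∀ {w} → Sat ρ w Γ → Sat ρ w ⟪ L ⟫
  sound* d ups sat φ∈L = sound (d _ φ∈L) ups sat

  -- Only ⇒ and ≺ look at other worlds.
  depth : ∀ {V : Set} → Fm V → ℕ
  depth (var _)  = 0
  depth ⊥ᶠ       = 0
  depth ⊤ᶠ       = 0
  depth (a ∧ᶠ b) = depth a ⊔ depth b
  depth (a ∨ᶠ b) = depth a ⊔ depth b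
  depth (a ⇒ b)  = suc (depth a ⊔ depth b)
  depth (a ≺ b)  = suc (depth a ⊔ depth b)

  module Locality (rank : World → ℕ)
                  (rank-≼ : ∀ {w v} → w ≼ v ⊎ v ≼ w → rank v ≤ suc (rank w)) where

    Agree : ℕ → Val → Val → Set
    Agree n f g = ∀ {w} → rank w ≤ n → f w ≡ g w

    private
      next : ∀ {n w v} → rank w ≤ n → w ≼ v ⊎ v ≼ w → rank v ≤ suc n
      next r w~v = ≤-trans (rank-≼ w~v) (s≤s r)

      shift : ∀ {n d f g} → Agree (n + suc d) f g → Agree (suc n + d) f g
      shift {n} {d} {f} {g} = subst (λ m → Agree m f g) (+-suc n d)

    ⟦⟧-local : ∀ {V : Set} (φ : Fm V) {n d} {ρ ρ' : V → Val} → depth φ ≤ d →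
               (∀ v → Agree (n + d) (ρ v) (ρ' v)) → Agree n (⟦ φ ⟧ ρ) (⟦ φ ⟧ ρ')
    ⟦⟧-local (var v) {n} _ e r = e v (≤-trans r (m≤m+n n _))
    ⟦⟧-local ⊥ᶠ       _ _ _ = refl
    ⟦⟧-local ⊤ᶠ       _ _ _ = refl
    ⟦⟧-local (a ∧ᶠ b) d≤ e r =
      ∧ᵛ-cong (⟦⟧-local a (m⊔n≤o⇒m≤o _ _ d≤) e r) (⟦⟧-local b (m⊔n≤o⇒n≤o _ _ d≤) e r)
    ⟦⟧-local (a ∨ᶠ b) d≤ e r =
      ∨ᵛ-cong (⟦⟧-local a (m⊔n≤o⇒m≤o _ _ d≤) e r) (⟦⟧-local b (m⊔n≤o⇒n≤o _ _ d≤) e r)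
    ⟦⟧-local (a ⇒ b) (s≤s d≤) e r =
      ⇒ᵛ-cong (λ w≼v → ⟦⟧-local a (m⊔n≤o⇒m≤o _ _ d≤) (shift ∘ e) (next r (inj₁ w≼v)))
              (λ w≼v → ⟦⟧-local b (m⊔n≤o⇒n≤o _ _ d≤) (shift ∘ e) (next r (inj₁ w≼v)))
    ⟦⟧-local (a ≺ b) (s≤s d≤) e r =
      ≺ᵛ-cong (λ v≼w → ⟦⟧-local a (m⊔n≤o⇒m≤o _ _ d≤) (shift ∘ e) (next r (inj₂ v≼w)))
              (λ v≼w → ⟦⟧-local b (m⊔n≤o⇒n≤o _ _ d≤) (shift ∘ e) (next r (inj₂ v≼w)))

  valuation : List Val → ℕ → Val
  valuation []       _       = ⊤ᵛ
  valuation (f ∷ fs) zero    = f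
  valuation (f ∷ fs) (suc n) = valuation fs n

  valuation-upsets : ∀ {fs} → All Upset fs → Upsets (valuation fs)
  valuation-upsets []         _       = ⊤ᵛ-upset
  valuation-upsets (uf ∷ ufs) zero    = uf
  valuation-upsets (uf ∷ ufs) (suc n) = valuation-upsets ufs n

  ⟨_,_⟩ᵛ : Val → Val → Two → Val
  ⟨ f , g ⟩ᵛ zero       = f
  ⟨ f , g ⟩ᵛ (suc zero) = g

  module Δ-semantics (Δ : List (Fm Two)) where

    _⊩Δ⟨_,_⟩ : World → Val → Val → Set
    w ⊩Δ⟨ f , g ⟩ = ∀ {δ} → δ ∈ Δ → T (⟦ δ ⟧ ⟨ f , g ⟩ᵛ w)

    private
      ⟦⟧-sub-pair : ∀ {ρ} φ ψ δ → ⟦ sub ⟨ φ , ψ ⟩ δ ⟧ ρ ≗ ⟦ δ ⟧ ⟨ ⟦ φ ⟧ ρ , ⟦ ψ ⟧ ρ ⟩ᵛ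
      ⟦⟧-sub-pair φ ψ = ⟦⟧-sub ⟨ φ , ψ ⟩ λ { zero _ → refl ; (suc zero) _ → refl }

    sat⇒⊩Δ : ∀ {ρ w} φ ψ → Sat ρ w ⟪ Δ[ φ , ψ ] Δ ⟫ → w ⊩Δ⟨ ⟦ φ ⟧ ρ , ⟦ ψ ⟧ ρ ⟩
    sat⇒⊩Δ φ ψ sat {δ} δ∈ = subst T (⟦⟧-sub-pair φ ψ δ _) (sat (∈-map⁺ (sub ⟨ φ , ψ ⟩) δ∈))

    ⊩Δ⇒sat : ∀ {ρ w} φ ψ → w ⊩Δ⟨ ⟦ φ ⟧ ρ , ⟦ ψ ⟧ ρ ⟩ → Sat ρ w ⟪ Δ[ φ , ψ ] Δ ⟫
    ⊩Δ⇒sat φ ψ h χ∈ with ∈-map⁻ (sub ⟨ φ , ψ ⟩) χ∈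
    ... | δ , δ∈ , refl = subst T (sym (⟦⟧-sub-pair φ ψ δ _)) (h δ∈)

    ⊩Δ-refl : CondR Δ → ∀ {f} → Upset f → ∀ w → w ⊩Δ⟨ f , f ⟩
    ⊩Δ-refl cR uf _ = sat⇒⊩Δ x x (sound* cR (λ _ → uf) λ ())

    ⊩Δ-compatible : CondRe Δ → ∀ c {ρ} → Upsets ρ → ∀ {w} →
                    (∀ i → w ⊩Δ⟨ ⟦ xs (arity c) i ⟧ ρ , ⟦ ys (arity c) i ⟧ ρ ⟩) →
                    w ⊩Δ⟨ ⟦ applyC c (xs (arity c)) ⟧ ρ , ⟦ applyC c (ys (arity c)) ⟧ ρ ⟩
    ⊩Δ-compatible cRe c ups hyp =
      sat⇒⊩Δ _ _ (sound* (cRe c) ups λ (i , φ∈) → ⊩Δ⇒sat (xs _ i) (ys _ i) (hyp i) φ∈)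

    ⊩Δ-detach : CondMP Δ → ∀ {f g} → Upset f → Upset g → ∀ {w} → w ⊩Δ⟨ f , g ⟩ → T (f w) → T (g w)
    ⊩Δ-detach cMP uf ug h fw = sound cMP (valuation-upsets (uf ∷ ug ∷ [])) premises
      where
      premises : Sat _ _ (λ φ → φ ≡ x ⊎ φ ∈ Δ[ x , y ] Δ)
      premises (inj₁ refl) = fw
      premises (inj₂ φ∈)   = ⊩Δ⇒sat x y h φ∈

    -- valuation (x₁ ∷ y₁ ∷ x₂ ∷ y₂ ∷ []) assigns the variables xs 2 i, ys 2 i of (Re).
    ⊩Δ-∼ᵛ : CondR Δ → CondRe Δ → ∀ {f g} → Upset f → Upset g → ∀ {w} →
            w ⊩Δ⟨ f , g ⟩ → w ⊩Δ⟨ ∼ᵛ f , ∼ᵛ g ⟩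
    ⊩Δ-∼ᵛ cR cRe uf ug h = ⊩Δ-compatible cRe c≺ (valuation-upsets (⊤ᵛ-upset ∷ ⊤ᵛ-upset ∷ uf ∷ ug ∷ []))
      λ { zero → ⊩Δ-refl cR ⊤ᵛ-upset _ ; (suc zero) → h }

    ⊩Δ-¬ᵛ : CondR Δ → CondRe Δ → ∀ {f g} → Upset f → Upset g → ∀ {w} →
            w ⊩Δ⟨ f , g ⟩ → w ⊩Δ⟨ ¬ᵛ f , ¬ᵛ g ⟩
    ⊩Δ-¬ᵛ cR cRe uf ug h = ⊩Δ-compatible cRe c⇒ (valuation-upsets (uf ∷ ug ∷ ⊥ᵛ-upset ∷ ⊥ᵛ-upset ∷ []))
      λ { zero → h ; (suc zero) → ⊩Δ-refl cR ⊥ᵛ-upset _ }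

  tower : ℕ → Val → Val
  tower zero    f = ∼ᵛ f
  tower (suc j) f = ∼ᵛ (¬ᵛ tower j f)

  tower-upset : ∀ j {f} → Upset (tower j f)
  tower-upset zero    = ≺ᵛ-upset
  tower-upset (suc j) = ≺ᵛ-upset

  tower-⊤ᵛ-refuted : ∀ j → Refuted (tower j ⊤ᵛ)
  tower-⊤ᵛ-refuted zero    = ∼ᵛ-of-valid λ _ → _
  tower-⊤ᵛ-refuted (suc j) = ∼ᵛ-of-valid (¬ᵛ-of-refuted (tower-⊤ᵛ-refuted j))

module Fence where

  data World : Set where
    lo hi : ℕ → World

  data _≼_ : World → World → Set where
    ≼-refl   : ∀ {w} → w ≼ w
    lo≼hi    : ∀ {n} → lo n ≼ hi n
    sucLo≼hi : ∀ {n} → lo (suc n) ≼ hi n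

  ≼-trans : ∀ {u v w} → u ≼ v → v ≼ w → u ≼ w
  ≼-trans ≼-refl   q      = q
  ≼-trans lo≼hi    ≼-refl = lo≼hi
  ≼-trans sucLo≼hi ≼-refl = sucLo≼hi

  up down : World → List World
  up (lo zero)    = lo zero ∷ hi zero ∷ []
  up (lo (suc n)) = lo (suc n) ∷ hi (suc n) ∷ hi n ∷ []
  up (hi n)       = hi n ∷ []
  down (lo n) = lo n ∷ []
  down (hi n) = hi n ∷ lo n ∷ lo (suc n) ∷ []

  ∈-up : ∀ {w v} → v ∈ up w ⇔ w ≼ v
  ∈-up = mk⇔ up⁻ up⁺
    where
    up⁻ : ∀ {w v} → v ∈ up w → w ≼ v
    up⁻ {lo zero}    (here refl)                 = ≼-refl
    up⁻ {lo zero}    (there (here refl))         = lo≼hi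
    up⁻ {lo (suc n)} (here refl)                 = ≼-refl
    up⁻ {lo (suc n)} (there (here refl))         = lo≼hi
    up⁻ {lo (suc n)} (there (there (here refl))) = sucLo≼hi
    up⁻ {hi n}       (here refl)                 = ≼-refl
    up⁺ : ∀ {w v} → w ≼ v → v ∈ up w
    up⁺ {lo zero}    ≼-refl = here refl
    up⁺ {lo (suc n)} ≼-refl = here refl
    up⁺ {hi n}       ≼-refl = here refl
    up⁺ {lo zero}    lo≼hi  = there (here refl)
    up⁺ {lo (suc n)} lo≼hi  = there (here refl)
    up⁺ sucLo≼hi            = there (there (here refl))

  ∈-down : ∀ {w v} → v ∈ down w ⇔ v ≼ w
  ∈-down = mk⇔ down⁻ down⁺
    where
    down⁻ : ∀ {w v} → v ∈ down w → v ≼ w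
    down⁻ {lo n} (here refl)                 = ≼-refl
    down⁻ {hi n} (here refl)                 = ≼-refl
    down⁻ {hi n} (there (here refl))         = lo≼hi
    down⁻ {hi n} (there (there (here refl))) = sucLo≼hi
    down⁺ : ∀ {w v} → v ≼ w → v ∈ down w
    down⁺ {lo n} ≼-refl   = here refl
    down⁺ {hi n} ≼-refl   = here refl
    down⁺        lo≼hi    = there (here refl)
    down⁺        sucLo≼hi = there (there (here refl))

  frame : Frame
  frame = record
    { World = World ; _≼_ = _≼_ ; ≼-refl = ≼-refl ; ≼-trans = ≼-trans
    ; up = up ; down = down ; ∈-up = ∈-up ; ∈-down = ∈-down }

  rank : World → ℕ
  rank (lo n) = n
  rank (hi n) = n

  rank-≼ : ∀ {w v} → w ≼ v ⊎ v ≼ w → rank v ≤ suc (rank w)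
  rank-≼ (inj₁ ≼-refl)   = n≤1+n _
  rank-≼ (inj₁ lo≼hi)    = n≤1+n _
  rank-≼ (inj₁ sucLo≼hi) = m≤n⇒m≤1+n (n≤1+n _)
  rank-≼ (inj₂ ≼-refl)   = n≤1+n _
  rank-≼ (inj₂ lo≼hi)    = n≤1+n _
  rank-≼ (inj₂ sucLo≼hi) = ≤-refl

open Fence
open Kripke frame

punctured : ℕ → Val
punctured N (lo n) = not (n ≡ᵇ N)
punctured N (hi _) = true

punctured-upset : ∀ {N} → Upset (punctured N)
punctured-upset ≼-refl   p = p
punctured-upset lo≼hi    _ = _
punctured-upset sucLo≼hi _ = _

punctured-refuted-at : ∀ N → ¬ T (punctured N (lo N))
punctured-refuted-at zero    = λ ()
punctured-refuted-at (suc N) = punctured-refuted-at N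

punctured-below : ∀ {N n} → n < N → punctured N (lo n) ≡ true
punctured-below {suc N} {zero}  _         = refl
punctured-below {suc N} {suc n} (s≤s n<N) = punctured-below n<N

-- Each ∼¬ moves the refuting world one step down the fence, from lo N towards lo 0.
tower-punctured : ∀ j {m N} → j + m ≡ N → T (tower j (punctured N) (lo m))
tower-punctured zero    {m}     refl = from T-≺ᵛ (lo m , ≼-refl , _ , punctured-refuted-at m)
tower-punctured (suc j) {m} {N} e    = from T-≺ᵛ (lo m , ≼-refl , _ , λ ¬t → to T-⇒ᵛ ¬t lo≼hi at-hi)
  where
  at-hi : T (tower j (punctured N) (hi m))
  at-hi = tower-upset j sucLo≼hi (tower-punctured j (trans (+-suc j m) e))

module Towers (Δ : List (Fm Two)) (cR : CondR Δ) (cRe : CondRe Δ) where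
  open Δ-semantics Δ
  open Locality rank rank-≼

  N : ℕ
  N = suc (max 0 (map depth Δ))

  -- Δ is too shallow to see lo N, the only world where ⊤ᵛ and punctured N differ.
  ⊩Δ⟨⊤ᵛ,punctured⟩ : lo 0 ⊩Δ⟨ ⊤ᵛ , punctured N ⟩
  ⊩Δ⟨⊤ᵛ,punctured⟩ {δ} δ∈ =
    subst T (⟦⟧-local δ depth-δ agree z≤n) (⊩Δ-refl cR ⊤ᵛ-upset (lo 0) δ∈)
    where
    depth-δ : depth δ ≤ max 0 (map depth Δ)
    depth-δ = All.lookup (xs≤max 0 (map depth Δ)) (∈-map⁺ depth δ∈)
    agree : ∀ v → Agree (0 + max 0 (map depth Δ)) (⟨ ⊤ᵛ , ⊤ᵛ ⟩ᵛ v) (⟨ ⊤ᵛ , punctured N ⟩ᵛ v)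
    agree zero       _        = refl
    agree (suc zero) {lo _} r = sym (punctured-below (s≤s r))
    agree (suc zero) {hi _} _ = refl

  ⊩Δ-tower : ∀ j → lo 0 ⊩Δ⟨ tower j ⊤ᵛ , tower j (punctured N) ⟩
  ⊩Δ-tower zero    = ⊩Δ-∼ᵛ cR cRe ⊤ᵛ-upset punctured-upset ⊩Δ⟨⊤ᵛ,punctured⟩
  ⊩Δ-tower (suc j) =
    ⊩Δ-∼ᵛ cR cRe ⇒ᵛ-upset ⇒ᵛ-upset (⊩Δ-¬ᵛ cR cRe (tower-upset j) (tower-upset j) (⊩Δ-tower j))

mainTheorem6 : ¬ FinitelyEquivalential
mainTheorem6 (Δ , cR , cMP , cRe) = ¬B (⊩Δ-detach cMP ⇒ᵛ-upset ⇒ᵛ-upset ⊩Δ⟨A,B⟩ A)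
  where
  open Δ-semantics Δ
  open Towers Δ cR cRe

  ⊩Δ⟨A,B⟩ : lo 0 ⊩Δ⟨ ¬ᵛ tower N ⊤ᵛ , ¬ᵛ tower N (punctured N) ⟩
  ⊩Δ⟨A,B⟩ = ⊩Δ-¬ᵛ cR cRe (tower-upset N) (tower-upset N) (⊩Δ-tower N)

  A : T ((¬ᵛ tower N ⊤ᵛ) (lo 0))
  A = ¬ᵛ-of-refuted (tower-⊤ᵛ-refuted N) (lo 0)

  ¬B : ¬ T ((¬ᵛ tower N (punctured N)) (lo 0))
  ¬B b = to T-⇒ᵛ b ≼-refl (tower-punctured N (+-identityʳ N))
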